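{- Let $R$ be a finite digraph and let $\mathfrak{D}'$ be a class of finite digraphs, and assume one of the following holds: (i) $\mathfrak{D}' = \mathfrak{D}$ (and $R\in\mathfrak{D}$ arbitrary); (ii) $R \in \mathfrak{T}_a$ and $\mathfrak{T}_a \subseteq \mathfrak{D}' \subseteq \mathfrak{D}$; (iii) $\mathfrak{D}' = \mathfrak{P}$ or $\mathfrak{D}' = \mathfrak{P}^*$, and $R \in \mathfrak{D}'$. Then for every finite digraph $S$: $$R \sqsubseteq_\Gamma S \text{ with respect to } \mathfrak{D}' \iff \#\mathcal{S}(G,R) \le \#\mathcal{S}(G,S) \text{ for all } G \in \mathfrak{D}',$$ and moreover $$\#\mathcal{S}(G,R) \le \#\mathcal{S}(G,S) \text{ for all } G \in \mathfrak{D}' \;\Longrightarrow\; \#\mathcal{H}(G,R) \le \#\mathcal{H}(G,S) \text{ for all } G \in \mathfrak{D}'.$$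
   Context: A digraph $G=(V(G),A(G))$ has a finite non-empty vertex set $V(G)$ and arc set $A(G)\subseteq V(G)\times V(G)$; $vw$ denotes the pair $(v,w)$. An arc $vv$ is a loop; an arc $vw$ with $v\neq w$ is proper. $G^*=(V(G),A(G)\setminus\{vv: v\in V(G)\})$. A homomorphism $\xi:G\to H$ is a map $V(G)\to V(H)$ with $\xi(v)\xi(w)\in A(H)$ for all $vw\in A(G)$; $\mathcal{H}(G,H)$ is the set of homomorphisms. A homomorphism is strict if it maps every proper arc of $G$ to a proper arc of $H$; $\mathcal{S}(G,H)=\mathcal{H}(G,H)\cap\mathcal{H}(G^*,H^*)$ is the set of strict homomorphisms. A walk is a sequence $v_0,\dots,v_I$ ($I\ge 1$) with $v_{i-1}v_i\in A(G)$ for all $i$; it is closed if $v_0=v_I$; a digraph is acyclic if it has no closed walk. Classes: $\mathfrak{D}$ = all finite digraphs; $\mathfrak{P}$ = finite posets (reflexive, antisymmetric, transitive digraphs); $\mathfrak{P}^*=\{P^*: P\in\mathfrak{P}\}$; $\mathfrak{T}_a=\{G\in\mathfrak{D}: G^* \text{ is acyclic}\}$. Vertices $v,w$ are adjacent if $vw\in A(G)$ or $wv\in A(G)$. For $X\subseteq V(G)$ and $v\in X$, $\gamma_X(v)$ is the set of $w\in X$ such that $w=v$ or there are $z_0=v,z_1,\dots,z_I=w$ in $X$ with $z_{i-1},z_i$ adjacent for all $i$. For a map $\xi$ defined on $V(G)$, $\Gamma_\xi(v)=\gamma_{\xi^{ -1}(\xi(v))}(v)$. For a class $\mathfrak{D}'$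 let $\mathfrak{D}'_r$ be a system of representatives of $\mathfrak{D}'$ up to isomorphism. A Hom-scheme from $R$ to $S$ with respect to $\mathfrak{D}'$ is a family $\rho=(\rho_G)_{G\in\mathfrak{D}'_r}$ of maps $\rho_G:\mathcal{H}(G,R)\to\mathcal{H}(G,S)$; it is strong if every $\rho_G$ is injective, and it is a $\Gamma$-scheme if $\Gamma_{\rho_G(\xi)}(v)=\Gamma_\xi(v)$ for all $G\in\mathfrak{D}'_r$, $\xi\in\mathcal{H}(G,R)$, $v\in V(G)$. We write $R\sqsubseteq_\Gamma S$ (with respect to $\mathfrak{D}'$) iff a strong $\Gamma$-scheme from $R$ to $S$ with respect to $\mathfrak{D}'$ exists. -}

module Defs where

open import Data.Nat using (ℕ; zero; suc; _≤_)
open import Data.Bool using (Bool; true; false; _∧_; not)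
open import Data.Fin using (Fin)
open import Data.Fin.Properties using (all?) renaming (_≟_ to _≟ᶠ_)
open import Data.Vec using (Vec; []; _∷_; lookup; tabulate)
open import Data.List using (List; [_]; concatMap; map; filter; length; allFin)
open import Data.Product using (Σ; _×_; _,_; proj₁)
open import Data.Sum using (_⊎_)
open import Relation.Nullary using (¬_; Dec; yes; no)
open import Relation.Nullary.Decidable using (⌊_⌋; _×-dec_; _→-dec_)
open import Relation.Binary.PropositionalEquality using (_≡_; _≢_)
open import Data.Bool.Properties using () renaming (_≟_ to _≟ᵇ_)
open import Function.Bundles using (_⇔_)

-- A finite digraph: vertex set Fin (suc k) (finite, non-empty),
-- arc set given by a Boolean adjacency matrix.
record Digraph : Set where
  constructor digraph
  field
    k   : ℕ
    adj : Vec (Vec Bool (suc k)) (suc k)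

open Digraph public

V : Digraph → Set
V G = Fin (suc (k G))

Arc : (G : Digraph) → V G → V G → Set
Arc G v w = lookup (lookup (adj G) v) w ≡ true

arc? : (G : Digraph) → (v w : V G) → Dec (Arc G v w)
arc? G v w = lookup (lookup (adj G) v) w ≟ᵇ true

star : Digraph → Digraph
star G = digraph (k G)
  (tabulate λ v → tabulate λ w →
     lookup (lookup (adj G) v) w ∧ not ⌊ v ≟ᶠ w ⌋)

-- maps V(G) → V(H), represented as vectors (first-order, so that
-- equality of maps is ordinary equality)
Map : Digraph → Digraph → Set
Map G H = Vec (V H) (suc (k G))

app : ∀ {G H} → Map G H → V G → V H
app ξ v = lookup ξ v

IsHom : (G H : Digraph) → Map G H → Set
IsHom G H ξ = ∀ v w → Arc G v w → Arc H (app {G} {H} ξ v) (app {G} {H} ξ w)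

isHom? : (G H : Digraph) (ξ : Map G H) → Dec (IsHom G H ξ)
isHom? G H ξ = all? λ v → all? λ w →
  arc? G v w →-dec arc? H (app {G} {H} ξ v) (app {G} {H} ξ w)

Hom : Digraph → Digraph → Set
Hom G H = Σ (Map G H) (IsHom G H)

IsStrict : (G H : Digraph) → Map G H → Set
IsStrict G H ξ = IsHom G H ξ × IsHom (star G) (star H) ξ

isStrict? : (G H : Digraph) (ξ : Map G H) → Dec (IsStrict G H ξ)
isStrict? G H ξ = isHom? G H ξ ×-dec isHom? (star G) (star H) ξ

allVecs : (n m : ℕ) → List (Vec (Fin m) n)
allVecs zero    m = [ [] ]
allVecs (suc n) m = concatMap (λ xs → map (λ x → x ∷ xs) (allFin m)) (allVecs n m)

allMaps : (G H : Digraph) → List (Map G H)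
allMaps G H = allVecs (suc (k G)) (suc (k H))

#Hom : Digraph → Digraph → ℕ
#Hom G H = length (filter (isHom? G H) (allMaps G H))

#Strict : Digraph → Digraph → ℕ
#Strict G H = length (filter (isStrict? G H) (allMaps G H))

Adj : (G : Digraph) → V G → V G → Set
Adj G v w = Arc G v w ⊎ Arc G w v

-- γ_X(v) : w ∈ γ_X(v) iff w = v or there is a chain v = z₀,…,z_I = w in X
-- of successively adjacent vertices  (used with v ∈ X)
data Conn (G : Digraph) (X : V G → Set) (v : V G) : V G → Set where
  here : Conn G X v v
  step : ∀ {u w} → Conn G X v u → X w → Adj G u w → Conn G X v w

Γ : ∀ {G H} → Map G H → V G → V G → Set
Γ {G} {H} ξ v w = Conn G (λ u → app {G} {H} ξ u ≡ app {G} {H} ξ v) v w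

data Walk (G : Digraph) : V G → V G → Set where
  one  : ∀ {v w} → Arc G v w → Walk G v w
  cons : ∀ {u v w} → Arc G u v → Walk G v w → Walk G u w

Acyclic : Digraph → Set
Acyclic G = ∀ v → ¬ Walk G v v

InTa : Digraph → Set
InTa G = Acyclic (star G)

IsPoset : Digraph → Set
IsPoset G = (∀ v → Arc G v v)
          × (∀ v w → Arc G v w → Arc G w v → v ≡ w)
          × (∀ u v w → Arc G u v → Arc G v w → Arc G u w)

InPStar : Digraph → Set
InPStar G = Σ Digraph λ P → IsPoset P × (star P ≡ G)

Class : Set₁
Class = Digraph → Set

record StrongΓScheme (D' : Class) (R S : Digraph) : Set where
  field
    ρ      : (G : Digraph) → D' G → Hom G R → Hom G S
    strong : ∀ G (d : D' G) (ξ₁ ξ₂ : Hom G R)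
             → proj₁ (ρ G d ξ₁) ≡ proj₁ (ρ G d ξ₂) → proj₁ ξ₁ ≡ proj₁ ξ₂
    Γ-pres : ∀ G (d : D' G) (ξ : Hom G R) (v w : V G)
             → Γ {G} {S} (proj₁ (ρ G d ξ)) v w ⇔ Γ {G} {R} (proj₁ ξ) v w

_⊑Γ_wrt_ : Digraph → Digraph → Class → Set
R ⊑Γ S wrt D' = StrongΓScheme D' R S

StrictLeq : Class → Digraph → Digraph → Set
StrictLeq D' R S = ∀ G → D' G → #Strict G R ≤ #Strict G S

HomLeq : Class → Digraph → Digraph → Set
HomLeq D' R S = ∀ G → D' G → #Hom G R ≤ #Hom G S

Hyp : Class → Digraph → Set
Hyp D' R =
    (∀ G → D' G)
  ⊎ (InTa R × (∀ G → InTa G → D' G))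
  ⊎ (((∀ G → D' G ⇔ IsPoset G) ⊎ (∀ G → D' G ⇔ InPStar G)) × D' R)

-- A strong Γ-scheme maps strict homomorphisms (those with trivial Γ) injectively to strict
-- homomorphisms, and homomorphisms injectively to homomorphisms, which gives both inequalities.
-- Conversely, Γ_ξ relates the vertices joined by arcs that ξ collapses; contracting these
-- components yields a quotient Q through which ξ factors as a strict map ξ̄.  The counting
-- hypothesis gives, for every member Q′ of 𝔇′, an injection 𝓢(Q′,R) ↪ 𝓢(Q′,S); sending ξ̄ to its
-- image ζ̄ and ξ to ζ̄ ∘ (G ↠ Q) yields a homomorphism with the same Γ, and ξ is recovered from
-- Γ_ξ and ξ̄.  In cases (i) and (ii) Q itself lies in 𝔇′ (a strict map into R reflects
-- acyclicity of Q*); for posets Q is replaced by its reflexive-transitive closure, on which ξ̄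
-- stays strict; for 𝔓* every homomorphism into the loopless R is already strict, so no quotient
-- is needed.
module Submission where

open import Defs
open import Data.Bool using (Bool; true; false; _∧_; not)
import Data.Bool.Properties as Bool
open import Data.Fin using (Fin; zero; suc; inject≤)
open import Data.Fin.Properties using (_≟_; any?; injective⇒≤; inject≤-injective)
open import Data.Fin.Subset using (Subset; ⁅_⁆; _∪_; _⊃_) renaming (_∈_ to _∈ₛ_; _∉_ to _∉ₛ_)
open import Data.Fin.Subset.Properties using (_∈?_; p⊆p∪q; x∈p∪q⁺; x∈p∪q⁻; x∈⁅x⁆; x∈⁅y⁆⇒x≡y)
open import Data.Fin.Subset.Induction using (Acc; acc; ⊃-wellFounded)
open import Data.List
  using (List; []; _∷_; _++_; map; filter; length; allFin; concatMap; cartesianProductWith; deduplicate)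
import Data.List as List
import Data.List.Relation.Unary.All as All
open import Data.List.Relation.Unary.AllPairs using ([]; _∷_)
import Data.List.Relation.Unary.Any as Any
open import Data.List.Relation.Unary.Any using (here; index)
open import Data.List.Relation.Unary.Any.Properties using (lookup-index)
import Data.List.Relation.Unary.Unique.Setoid as SetoidUnique
open import Data.List.Relation.Unary.Unique.Propositional using (Unique)
import Data.List.Relation.Unary.Unique.Propositional.Properties as Unique
open import Data.List.Relation.Unary.Unique.DecSetoid.Properties using (deduplicate-!)
open import Data.List.Membership.Propositional using (_∈_)
open import Data.List.Membership.Propositional.Properties
  using (∈-lookup; ∈-allFin; ∈-filter⁺; ∈-filter⁻; ∈-cartesianProductWith⁺)
open import Data.List.Membership.Setoid.Properties using (∈-deduplicate⁺)
open import Data.Nat using (ℕ; zero; suc; pred; _≤_)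
open import Data.Product using (Σ; ∃; ∃₂; _×_; _,_; proj₁; proj₂; swap)
open import Data.Sum using (inj₁; inj₂; [_,_])
open import Data.Vec using (Vec; []; _∷_; lookup; tabulate)
import Data.Vec.Properties as Vec
open import Function.Base using (_∘_; _on_)
open import Function.Bundles using (_⇔_; mk⇔; Equivalence)
import Function.Properties.Equivalence as ⇔
open import Level using (0ℓ)
open import Relation.Binary using (Setoid; DecSetoid; Rel; _⇒_; IsEquivalence)
open import Relation.Binary.Definitions using () renaming (Decidable to Decidable₂)
open import Relation.Binary.Construct.Closure.ReflexiveTransitive as Star using (Star; ε; _◅_; _◅◅_)
open import Relation.Binary.Construct.Closure.Symmetric using (SymClosure; fwd; bwd)
open import Relation.Binary.Construct.Closure.Equivalence using (EqClosure)
import Relation.Binary.Construct.Closure.Equivalence as EqClosure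
import Relation.Binary.Construct.Subst.Equality as SubstEquality
open import Relation.Binary.PropositionalEquality hiding ([_]) renaming (isEquivalence to ≡-isEquivalence)
open import Relation.Nullary using (¬_; Dec; yes; no; does; ¬?; contradiction)
open import Relation.Nullary.Decidable using (⌊_⌋; _×-dec_; _⊎-dec_; map′; decidable-stable; does-⇔)
open import Relation.Unary using (Pred; Decidable)

open Equivalence using (to; from)

module _ {a ℓ} (S : Setoid a ℓ) where
  open Setoid S using (_≈_) renaming (sym to ≈-sym)

  lookup-injective : ∀ {xs} → SetoidUnique.Unique S xs → ∀ {i j} → List.lookup xs i ≈ List.lookup xs j → i ≡ j
  lookup-injective (_  ∷ _)   {zero}  {zero}  _  = refl
  lookup-injective (x≉ ∷ _)   {zero}  {suc j} x≈ = contradiction x≈ (All.lookup x≉ (∈-lookup j))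
  lookup-injective (x≉ ∷ _)   {suc i} {zero}  x≈ = contradiction (≈-sym x≈) (All.lookup x≉ (∈-lookup i))
  lookup-injective (_  ∷ xs!) {suc i} {suc j} x≈ = cong suc (lookup-injective xs! x≈)

module _ {A B : Set} {xs : List A} {ys : List B} where

  injection⇒length-≤ : Unique xs → (f : ∀ {x} → x ∈ xs → B) → (∀ {x} (x∈ : x ∈ xs) → f x∈ ∈ ys) →
                       (∀ {x y} (x∈ : x ∈ xs) (y∈ : y ∈ xs) → f x∈ ≡ f y∈ → x ≡ y) →
                       length xs ≤ length ys
  injection⇒length-≤ xs! f f-∈ f-injective = injective⇒≤ position-injective
    where
    position : Fin (length xs) → Fin (length ys)
    position i = index (f-∈ (∈-lookup i))

    position-injective : ∀ {i j} → position i ≡ position j → i ≡ j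
    position-injective {i} {j} eq = lookup-injective (setoid A) xs! (f-injective _ _ (begin
      f (∈-lookup i)              ≡⟨ lookup-index (f-∈ (∈-lookup i)) ⟩
      List.lookup ys (position i) ≡⟨ cong (List.lookup ys) eq ⟩
      List.lookup ys (position j) ≡⟨ lookup-index (f-∈ (∈-lookup j)) ⟨
      f (∈-lookup j)              ∎))
      where open ≡-Reasoning

  module Embedding (ys! : Unique ys) .(xs≤ys : length xs ≤ length ys) where

    embed : ∀ {x} → x ∈ xs → B
    embed x∈ = List.lookup ys (inject≤ (index x∈) xs≤ys)

    embed-∈ : ∀ {x} (x∈ : x ∈ xs) → embed x∈ ∈ ys
    embed-∈ _ = ∈-lookup _

    embed-injective : ∀ {x y} (x∈ : x ∈ xs) (y∈ : y ∈ xs) → embed x∈ ≡ embed y∈ → x ≡ y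
    embed-injective x∈ y∈ eq = begin
      _                         ≡⟨ lookup-index x∈ ⟩
      List.lookup xs (index x∈) ≡⟨ cong (List.lookup xs) (inject≤-injective xs≤ys xs≤ys _ _
                                                            (lookup-injective (setoid B) ys! eq)) ⟩
      List.lookup xs (index y∈) ≡⟨ lookup-index y∈ ⟨
      _                         ∎
      where open ≡-Reasoning

allVecs≡cartesianProduct : ∀ {n m} (vs : List (Vec (Fin m) n)) →
  concatMap (λ xs → map (λ x → x ∷ xs) (allFin m)) vs ≡ cartesianProductWith (λ xs x → x ∷ xs) vs (allFin m)
allVecs≡cartesianProduct []       = refl
allVecs≡cartesianProduct (v ∷ vs) = cong (_ ++_) (allVecs≡cartesianProduct vs)

∈-allVecs : ∀ n m (xs : Vec (Fin m) n) → xs ∈ allVecs n m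
∈-allVecs zero    m []       = here refl
∈-allVecs (suc n) m (x ∷ xs) = subst (_ ∈_) (sym (allVecs≡cartesianProduct (allVecs n m)))
  (∈-cartesianProductWith⁺ (λ xs x → x ∷ xs) (∈-allVecs n m xs) (∈-allFin x))

allVecs-unique : ∀ n m → Unique (allVecs n m)
allVecs-unique zero    m = All.[] ∷ []
allVecs-unique (suc n) m = subst Unique (sym (allVecs≡cartesianProduct (allVecs n m)))
  (Unique.cartesianProductWith⁺ _ (swap ∘ Vec.∷-injective) (allVecs-unique n m) (Unique.allFin⁺ m))

module _ (G H : Digraph) {p} {P : Pred (Map G H) p} (P? : Decidable P) where

  ∈-filter-allMaps⁺ : ∀ ξ → P ξ → ξ ∈ filter P? (allMaps G H)
  ∈-filter-allMaps⁺ ξ = ∈-filter⁺ P? (∈-allVecs _ _ ξ)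

  ∈-filter-allMaps⁻ : ∀ {ξ} → ξ ∈ filter P? (allMaps G H) → P ξ
  ∈-filter-allMaps⁻ = proj₂ ∘ ∈-filter⁻ P? {xs = allMaps G H}

  filter-allMaps-unique : Unique (filter P? (allMaps G H))
  filter-allMaps-unique = Unique.filter⁺ P? (allVecs-unique _ _)

#filter-allMaps-≤ : ∀ G H G′ H′ {p q} {P : Pred (Map G H) p} {Q : Pred (Map G′ H′) q}
                    (P? : Decidable P) (Q? : Decidable Q) (f : ∀ ξ → P ξ → Map G′ H′) →
                    (∀ ξ Pξ → Q (f ξ Pξ)) → (∀ ξ₁ Pξ₁ ξ₂ Pξ₂ → f ξ₁ Pξ₁ ≡ f ξ₂ Pξ₂ → ξ₁ ≡ ξ₂) →
                    length (filter P? (allMaps G H)) ≤ length (filter Q? (allMaps G′ H′))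
#filter-allMaps-≤ G H G′ H′ P? Q? f f-Q f-injective =
  injection⇒length-≤ (filter-allMaps-unique G H P?) (λ ξ∈ → f _ (∈-filter-allMaps⁻ G H P? ξ∈))
    (λ _ → ∈-filter-allMaps⁺ G′ H′ Q? _ (f-Q _ _)) (λ _ _ → f-injective _ _ _ _)

strictMaps : (G H : Digraph) → List (Map G H)
strictMaps G H = filter (isStrict? G H) (allMaps G H)

module _ {n ℓ} {_⟶_ : Rel (Fin n) ℓ} (_⟶?_ : Decidable₂ _⟶_) where

  private
    Closed : Subset n → Set ℓ
    Closed p = ∀ {u x} → u ∈ₛ p → u ⟶ x → x ∈ₛ p

    Closed⇒Star-closed : ∀ {p} → Closed p → ∀ {u x} → u ∈ₛ p → Star _⟶_ u x → x ∈ₛ p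
    Closed⇒Star-closed closed u∈p ε               = u∈p
    Closed⇒Star-closed closed u∈p (u⟶y ◅ y⟶⋆x) = Closed⇒Star-closed closed (closed u∈p u⟶y) y⟶⋆x

    p∪⁅x⁆⊃p : ∀ {p : Subset n} {x} → x ∉ₛ p → (p ∪ ⁅ x ⁆) ⊃ p
    p∪⁅x⁆⊃p {p} {x} x∉p = p⊆p∪q ⁅ x ⁆ , x , x∈p∪q⁺ (inj₂ (x∈⁅x⁆ x)) , x∉p

    saturate : ∀ {a} p → Acc _⊃_ p → a ∈ₛ p → (∀ {x} → x ∈ₛ p → Star _⟶_ a x) →
               Σ (Subset n) λ q → a ∈ₛ q × (∀ {x} → x ∈ₛ q → Star _⟶_ a x) × Closed q
    saturate p (acc larger) a∈p reached
      with any? (λ u → any? λ x → u ∈? p ×-dec (u ⟶? x ×-dec ¬? (x ∈? p)))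
    ... | yes (u , x , u∈p , u⟶x , x∉p) =
      saturate (p ∪ ⁅ x ⁆) (larger (p∪⁅x⁆⊃p x∉p)) (p⊆p∪q ⁅ x ⁆ a∈p) reached′
      where
      reached′ : ∀ {y} → y ∈ₛ p ∪ ⁅ x ⁆ → Star _⟶_ _ y
      reached′ y∈ with x∈p∪q⁻ p ⁅ x ⁆ y∈
      ... | inj₁ y∈p = reached y∈p
      ... | inj₂ y∈⁅x⁆ rewrite x∈⁅y⁆⇒x≡y x y∈⁅x⁆ = reached u∈p ◅◅ (u⟶x ◅ ε)
    ... | no nothing-new = p , a∈p , reached , λ {u} {x} u∈p u⟶x →
      decidable-stable (x ∈? p) λ x∉p → nothing-new (u , x , u∈p , u⟶x , x∉p)

  reachable? : Decidable₂ (Star _⟶_)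
  reachable? a x
    with saturate ⁅ a ⁆ (⊃-wellFounded _) (x∈⁅x⁆ a) (λ y∈ → subst (Star _⟶_ a) (sym (x∈⁅y⁆⇒x≡y a y∈)) ε)
  ... | p , a∈p , reached , closed = map′ reached (Closed⇒Star-closed closed a∈p) (x ∈? p)

symClosure? : ∀ {a ℓ} {A : Set a} {_∼_ : Rel A ℓ} → Decidable₂ _∼_ → Decidable₂ (SymClosure _∼_)
symClosure? _∼?_ x y =
  map′ [ fwd , bwd ] (λ { (fwd x∼y) → inj₁ x∼y ; (bwd y∼x) → inj₂ y∼x }) (x ∼? y ⊎-dec y ∼? x)

does≡true⇔ : ∀ {p} {P : Set p} (P? : Dec P) → does P? ≡ true ⇔ P
does≡true⇔ (yes p)  = mk⇔ (λ _ → p) (λ _ → refl)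
does≡true⇔ (no ¬p) = mk⇔ (λ ()) (λ p → contradiction p ¬p)

Matrix : ℕ → Set
Matrix n = Vec (Vec Bool n) n

toMatrix : ∀ {n ℓ} {_∼_ : Rel (Fin n) ℓ} → Decidable₂ _∼_ → Matrix n
toMatrix _∼?_ = tabulate λ v → tabulate λ w → does (v ∼? w)

toMatrix-entry : ∀ {n ℓ} {_∼_ : Rel (Fin n) ℓ} (_∼?_ : Decidable₂ _∼_) v w →
                 lookup (lookup (toMatrix _∼?_) v) w ≡ true ⇔ v ∼ w
toMatrix-entry _∼?_ v w
  rewrite Vec.lookup∘tabulate (λ v → tabulate λ w → does (v ∼? w)) v
        | Vec.lookup∘tabulate (λ w → does (v ∼? w)) w = does≡true⇔ (v ∼? w)

toMatrix-cong : ∀ {n ℓ₁ ℓ₂} {_∼₁_ : Rel (Fin n) ℓ₁} {_∼₂_ : Rel (Fin n) ℓ₂}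
                (_∼₁?_ : Decidable₂ _∼₁_) (_∼₂?_ : Decidable₂ _∼₂_) →
                (∀ v w → v ∼₁ w ⇔ v ∼₂ w) → toMatrix _∼₁?_ ≡ toMatrix _∼₂?_
toMatrix-cong _∼₁?_ _∼₂?_ ∼₁⇔∼₂ =
  Vec.tabulate-cong λ v → Vec.tabulate-cong λ w → does-⇔ (∼₁⇔∼₂ v w) (v ∼₁? w) (v ∼₂? w)

Arc-star : ∀ G v w → Arc (star G) v w ⇔ (Arc G v w × v ≢ w)
Arc-star G v w
  rewrite Vec.lookup∘tabulate (λ v → tabulate λ w → lookup (lookup (adj G) v) w ∧ not ⌊ v ≟ w ⌋) v
        | Vec.lookup∘tabulate (λ w → lookup (lookup (adj G) v) w ∧ not ⌊ v ≟ w ⌋) w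
  with lookup (lookup (adj G) v) w | v ≟ w
... | true  | no v≢w  = mk⇔ (λ _ → refl , v≢w) (λ _ → refl)
... | true  | yes refl = mk⇔ (λ ()) (λ (_ , v≢v) → contradiction refl v≢v)
... | false | _        = mk⇔ (λ ()) λ { (() , _) }

P*-loopless : ∀ {G} → InPStar G → ∀ v → ¬ Arc G v v
P*-loopless (P , _ , refl) v v⟶v = proj₂ (to (Arc-star P v v) v⟶v) refl

walk-map : ∀ {G H} {ξ : Map G H} → IsHom G H ξ → ∀ {v w} → Walk G v w → Walk H (lookup ξ v) (lookup ξ w)
walk-map ξ-hom (one v⟶w) = one (ξ-hom _ _ v⟶w)
walk-map {G} {H} {ξ} ξ-hom (cons u⟶v v⟶⋆w) = cons (ξ-hom _ _ u⟶v) (walk-map {G} {H} {ξ} ξ-hom v⟶⋆w)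

module _ {G H : Digraph} (ξ : Map G H) where

  Collapsed : Rel (V G) 0ℓ
  Collapsed u w = Arc G u w × lookup ξ u ≡ lookup ξ w

  collapsed? : Decidable₂ Collapsed
  collapsed? u w = arc? G u w ×-dec (lookup ξ u ≟ lookup ξ w)

  private
    Γ⇒same-image : ∀ {v w} → Γ {G} {H} ξ v w → lookup ξ w ≡ lookup ξ v
    Γ⇒same-image here               = refl
    Γ⇒same-image (step _ ξw≡ξv _) = ξw≡ξv

    Γ⇒EqClosure : ∀ {v w} → Γ {G} {H} ξ v w → EqClosure Collapsed v w
    Γ⇒EqClosure here = ε
    Γ⇒EqClosure (step {u} γ ξw≡ξv u~w) = Γ⇒EqClosure γ ◅◅ (collapsed u~w ◅ ε)
      where
      ξu≡ξw = trans (Γ⇒same-image γ) (sym ξw≡ξv)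
      collapsed : Adj G u _ → SymClosure Collapsed u _
      collapsed (inj₁ u⟶w) = fwd (u⟶w , ξu≡ξw)
      collapsed (inj₂ w⟶u) = bwd (w⟶u , sym ξu≡ξw)

    extend : ∀ {v u w} → Γ {G} {H} ξ v u → EqClosure Collapsed u w → Γ {G} {H} ξ v w
    extend γ ε = γ
    extend γ (fwd (u⟶y , ξu≡ξy) ◅ rest) = extend (step γ (trans (sym ξu≡ξy) (Γ⇒same-image γ)) (inj₁ u⟶y)) rest
    extend γ (bwd (y⟶u , ξy≡ξu) ◅ rest) = extend (step γ (trans ξy≡ξu (Γ⇒same-image γ)) (inj₂ y⟶u)) rest

  Γ⇔EqClosure : ∀ {v w} → Γ {G} {H} ξ v w ⇔ EqClosure Collapsed v w
  Γ⇔EqClosure = mk⇔ Γ⇒EqClosure (extend here)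

  componentMatrix : Matrix (suc (k G))
  componentMatrix = toMatrix (reachable? (symClosure? collapsed?))

  componentMatrix-entry : ∀ {v w} → lookup (lookup componentMatrix v) w ≡ true ⇔ EqClosure Collapsed v w
  componentMatrix-entry {v} {w} = toMatrix-entry (reachable? (symClosure? collapsed?)) v w

module _ {G H : Digraph} {ξ : Map G H} where

  strict⇒separating : IsStrict G H ξ → Collapsed {G} {H} ξ ⇒ _≡_
  strict⇒separating (_ , ξ*-hom) {u} {w} (u⟶w , ξu≡ξw) with u ≟ w
  ... | yes u≡w = u≡w
  ... | no u≢w  = contradiction ξu≡ξw
    (proj₂ (to (Arc-star H _ _) (ξ*-hom u w (from (Arc-star G u w) (u⟶w , u≢w)))))

  separating⇒strict : IsHom G H ξ → Collapsed {G} {H} ξ ⇒ _≡_ → IsStrict G H ξ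
  separating⇒strict ξ-hom separating = ξ-hom , λ u w u⟶*w →
    let u⟶w , u≢w = to (Arc-star G u w) u⟶*w
    in from (Arc-star H _ _) (ξ-hom u w u⟶w , λ ξu≡ξw → u≢w (separating (u⟶w , ξu≡ξw)))

  strict⇒Γ-trivial : IsStrict G H ξ → ∀ {v w} → Γ {G} {H} ξ v w → v ≡ w
  strict⇒Γ-trivial ξ-strict =
    EqClosure.fold ≡-isEquivalence (strict⇒separating ξ-strict) ∘ to (Γ⇔EqClosure {G} {H} ξ)

  Γ-trivial⇒strict : IsHom G H ξ → (∀ {v w} → Γ {G} {H} ξ v w → v ≡ w) → IsStrict G H ξ
  Γ-trivial⇒strict ξ-hom Γ-trivial =
    separating⇒strict ξ-hom (Γ-trivial ∘ from (Γ⇔EqClosure {G} {H} ξ) ∘ EqClosure.return)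

-- The quotient, factor and lift depend on the matrix B alone, not on the proof that it encodes an
-- equivalence, so equal matrices yield literally the same quotient digraph.
module Quotient (G : Digraph) (B : Matrix (suc (k G))) where

  _~_ : Rel (V G) 0ℓ
  v ~ w = lookup (lookup B v) w ≡ true

  _~?_ : Decidable₂ _~_
  v ~? w = lookup (lookup B v) w Bool.≟ true

  ~-decSetoid : IsEquivalence _~_ → DecSetoid 0ℓ 0ℓ
  ~-decSetoid ~-isEquivalence = record
    { isDecEquivalence = record { isEquivalence = ~-isEquivalence ; _≟_ = _~?_ } }

  opaque
    representatives : List (V G)
    representatives = deduplicate _~?_ (allFin _)

    -- deduplicate keeps the head zero of allFin, so suc m reduces to length representatives
    m : ℕ
    m = pred (length representatives)

    rep : Fin (suc m) → V G
    rep = List.lookup representatives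

    cls : V G → Fin (suc m)
    cls v with any? (λ i → v ~? rep i)
    ... | yes (i , _) = i
    ... | no _        = zero

    ~rep-cls : ∀ {v} → (∃ λ i → v ~ rep i) → v ~ rep (cls v)
    ~rep-cls {v} represented with any? (λ i → v ~? rep i)
    ... | yes (_ , v~) = v~
    ... | no unrepresented = contradiction represented unrepresented

    rep-injective : IsEquivalence _~_ → ∀ {i j} → rep i ~ rep j → i ≡ j
    rep-injective ~-isEquivalence = lookup-injective (DecSetoid.setoid (~-decSetoid ~-isEquivalence))
                                                     (deduplicate-! (~-decSetoid ~-isEquivalence) (allFin _))

    represented : IsEquivalence _~_ → ∀ v → ∃ λ i → v ~ rep i
    represented ~-isEquivalence v = index v∈ , lookup-index v∈
      where
      open IsEquivalence ~-isEquivalence renaming (refl to ~-refl; sym to ~-sym; trans to ~-trans)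
      v∈ : Any.Any (v ~_) representatives
      v∈ = ∈-deduplicate⁺ (DecSetoid.setoid (~-decSetoid ~-isEquivalence)) _~?_
             (λ z~y x~y → ~-trans x~y (~-sym z~y)) (Any.map (λ { refl → ~-refl }) (∈-allFin v))

  QuotientArc : Rel (Fin (suc m)) 0ℓ
  QuotientArc i j = ∃₂ λ v w → Arc G v w × v ~ rep i × w ~ rep j

  quotientArc? : Decidable₂ QuotientArc
  quotientArc? i j = any? λ v → any? λ w → arc? G v w ×-dec (v ~? rep i ×-dec w ~? rep j)

  quotient : Digraph
  quotient = digraph m (toMatrix quotientArc?)

  factor : ∀ {H} → Map G H → Map quotient H
  factor ξ = tabulate (lookup ξ ∘ rep)

  lift : ∀ {H} → Map quotient H → Map G H
  lift ζ̄ = tabulate (lookup ζ̄ ∘ cls)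

  lookup-lift : ∀ {H} (ζ̄ : Map quotient H) v → lookup (lift {H} ζ̄) v ≡ lookup ζ̄ (cls v)
  lookup-lift ζ̄ = Vec.lookup∘tabulate (lookup ζ̄ ∘ cls)

  module Properties (~-isEquivalence : IsEquivalence _~_) where
    open IsEquivalence ~-isEquivalence renaming (refl to ~-refl; sym to ~-sym; trans to ~-trans)

    ~rep∘cls : ∀ v → v ~ rep (cls v)
    ~rep∘cls v = ~rep-cls (represented ~-isEquivalence v)

    cls∘rep : ∀ i → cls (rep i) ≡ i
    cls∘rep i = rep-injective ~-isEquivalence (~-sym (~rep∘cls (rep i)))

    cls-≡⇔~ : ∀ {v w} → cls v ≡ cls w ⇔ v ~ w
    cls-≡⇔~ {v} {w} = mk⇔
      (λ eq → ~-trans (~rep∘cls v) (subst (λ i → rep i ~ w) (sym eq) (~-sym (~rep∘cls w))))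
      (λ v~w → rep-injective ~-isEquivalence (~-trans (~-sym (~rep∘cls v)) (~-trans v~w (~rep∘cls w))))

    Arc-cls : ∀ {v w} → Arc G v w → Arc quotient (cls v) (cls w)
    Arc-cls {v} {w} v⟶w =
      from (toMatrix-entry quotientArc? (cls v) (cls w)) (v , w , v⟶w , ~rep∘cls v , ~rep∘cls w)

    Arc-quotient : ∀ {i j} → Arc quotient i j → ∃₂ λ v w → Arc G v w × cls v ≡ i × cls w ≡ j
    Arc-quotient {i} {j} i⟶j with to (toMatrix-entry quotientArc? i j) i⟶j
    ... | v , w , v⟶w , v~ , w~ = v , w , v⟶w , cls-≡ i v~ , cls-≡ j w~
      where
      cls-≡ : ∀ {u} i → u ~ rep i → cls u ≡ i
      cls-≡ i u~ = trans (from cls-≡⇔~ u~) (cls∘rep i)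

    module _ {H : Digraph} where

      lookup-factor : (ξ : Map G H) → _~_ ⇒ (_≡_ on lookup ξ) → ∀ v → lookup ξ v ≡ lookup (factor {H} ξ) (cls v)
      lookup-factor ξ ξ-respects v =
        trans (ξ-respects (~rep∘cls v)) (sym (Vec.lookup∘tabulate (lookup ξ ∘ rep) (cls v)))

      lift∘factor : (ξ : Map G H) → _~_ ⇒ (_≡_ on lookup ξ) → lift {H} (factor {H} ξ) ≡ ξ
      lift∘factor ξ ξ-respects =
        trans (Vec.tabulate-cong λ v → sym (lookup-factor ξ ξ-respects v)) (Vec.tabulate∘lookup ξ)

      factor∘lift : (ζ̄ : Map quotient H) → factor {H} (lift {H} ζ̄) ≡ ζ̄
      factor∘lift ζ̄ =
        trans (Vec.tabulate-cong λ i → trans (lookup-lift {H} ζ̄ (rep i)) (cong (lookup ζ̄) (cls∘rep i)))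
              (Vec.tabulate∘lookup ζ̄)

      factor-strict : (ξ : Map G H) → IsHom G H ξ → _~_ ⇒ (_≡_ on lookup ξ) → Collapsed {G} {H} ξ ⇒ _~_ →
                      IsStrict quotient H (factor {H} ξ)
      factor-strict ξ ξ-hom ξ-respects collapsed⇒~ = separating⇒strict {quotient} {H} {ξ̄} ξ̄-hom ξ̄-separating
        where
        ξ̄ = factor {H} ξ

        lookup-ξ̄ : ∀ {v i} → cls v ≡ i → lookup ξ v ≡ lookup ξ̄ i
        lookup-ξ̄ {v} cls-v≡i = trans (lookup-factor ξ ξ-respects v) (cong (lookup ξ̄) cls-v≡i)

        ξ̄-hom : IsHom quotient H ξ̄
        ξ̄-hom i j i⟶j with Arc-quotient {i} {j} i⟶j
        ... | v , w , v⟶w , cls-v≡i , cls-w≡j =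
          subst₂ (Arc H) (lookup-ξ̄ cls-v≡i) (lookup-ξ̄ cls-w≡j) (ξ-hom v w v⟶w)

        ξ̄-separating : Collapsed {quotient} {H} ξ̄ ⇒ _≡_
        ξ̄-separating (i⟶j , ξ̄i≡ξ̄j) with Arc-quotient i⟶j
        ... | v , w , v⟶w , cls-v≡i , cls-w≡j = begin
          _     ≡⟨ cls-v≡i ⟨
          cls v ≡⟨ from cls-≡⇔~ (collapsed⇒~ (v⟶w , ξv≡ξw)) ⟩
          cls w ≡⟨ cls-w≡j ⟩
          _     ∎
          where
          open ≡-Reasoning
          ξv≡ξw = trans (lookup-ξ̄ cls-v≡i) (trans ξ̄i≡ξ̄j (sym (lookup-ξ̄ cls-w≡j)))

      lift-respects : (ζ̄ : Map quotient H) → _~_ ⇒ (_≡_ on lookup (lift {H} ζ̄))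
      lift-respects ζ̄ {v} {w} v~w = begin
        lookup (lift {H} ζ̄) v ≡⟨ lookup-lift {H} ζ̄ v ⟩
        lookup ζ̄ (cls v)      ≡⟨ cong (lookup ζ̄) (from cls-≡⇔~ v~w) ⟩
        lookup ζ̄ (cls w)      ≡⟨ lookup-lift {H} ζ̄ w ⟨
        lookup (lift {H} ζ̄) w ∎
        where open ≡-Reasoning

      lift-hom : (ζ̄ : Map quotient H) → IsHom quotient H ζ̄ → IsHom G H (lift {H} ζ̄)
      lift-hom ζ̄ ζ̄-hom v w v⟶w =
        subst₂ (Arc H) (sym (lookup-lift {H} ζ̄ v)) (sym (lookup-lift {H} ζ̄ w)) (ζ̄-hom _ _ (Arc-cls v⟶w))

      lift-collapsed : (ζ̄ : Map quotient H) → IsStrict quotient H ζ̄ → Collapsed {G} {H} (lift {H} ζ̄) ⇒ _~_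
      lift-collapsed ζ̄ ζ̄-strict {v} {w} (v⟶w , ζv≡ζw) = to cls-≡⇔~
        (strict⇒separating {quotient} {H} {ζ̄} ζ̄-strict
          (Arc-cls v⟶w , trans (sym (lookup-lift {H} ζ̄ v)) (trans ζv≡ζw (lookup-lift {H} ζ̄ w))))

record Completion (D' : Class) (R : Digraph) : Set₁ where
  field
    completion        : (Q : Digraph) → Matrix (suc (k Q))
    completion-⊇      : ∀ Q {i j} → Arc Q i j → Arc (digraph (k Q) (completion Q)) i j
    completion-strict : ∀ Q ξ̄ → IsStrict Q R ξ̄ → IsStrict (digraph (k Q) (completion Q)) R ξ̄
    completion-∈      : ∀ Q ξ̄ → IsStrict Q R ξ̄ → D' (digraph (k Q) (completion Q))

  completed : Digraph → Digraph
  completed Q = digraph (k Q) (completion Q)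

  strict-from-completed : ∀ {H} Q ζ̄ → IsStrict (completed Q) H ζ̄ → IsStrict Q H ζ̄
  strict-from-completed {H} Q ζ̄ ζ̄-strict = separating⇒strict {Q} {H} {ζ̄}
    (λ i j i⟶j → proj₁ ζ̄-strict i j (completion-⊇ Q i⟶j))
    (λ (i⟶j , ζ̄i≡ζ̄j) → strict⇒separating {completed Q} {H} {ζ̄} ζ̄-strict (completion-⊇ Q i⟶j , ζ̄i≡ζ̄j))

module Construction {D' : Class} {R S : Digraph} (C : Completion D' R) (R≼S : StrictLeq D' R S) where
  open Completion C

  module _ (G : Digraph) (B : Matrix (suc (k G))) where
    open Quotient G B

    private
      Q⁺ = completed quotient

      module Choice (ξ̄ : Map quotient R) (ξ̄-strict : IsStrict quotient R ξ̄) where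
        open Embedding {xs = strictMaps Q⁺ R} (filter-allMaps-unique Q⁺ S (isStrict? Q⁺ S))
                       (R≼S Q⁺ (completion-∈ quotient ξ̄ ξ̄-strict)) public

        ξ̄∈ : ξ̄ ∈ strictMaps Q⁺ R
        ξ̄∈ = ∈-filter-allMaps⁺ Q⁺ R (isStrict? Q⁺ R) ξ̄ (completion-strict quotient ξ̄ ξ̄-strict)

    chosen : ∀ ξ̄ → IsStrict quotient R ξ̄ → Map quotient S
    chosen ξ̄ ξ̄-strict = Choice.embed ξ̄ ξ̄-strict (Choice.ξ̄∈ ξ̄ ξ̄-strict)

    chosen-strict : ∀ ξ̄ ξ̄-strict → IsStrict quotient S (chosen ξ̄ ξ̄-strict)
    chosen-strict ξ̄ ξ̄-strict = strict-from-completed {S} quotient (chosen ξ̄ ξ̄-strict)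
      (∈-filter-allMaps⁻ Q⁺ S (isStrict? Q⁺ S) (Choice.embed-∈ ξ̄ ξ̄-strict (Choice.ξ̄∈ ξ̄ ξ̄-strict)))

    chosen-injective : ∀ ξ̄₁ ξ̄₁-strict ξ̄₂ ξ̄₂-strict → chosen ξ̄₁ ξ̄₁-strict ≡ chosen ξ̄₂ ξ̄₂-strict → ξ̄₁ ≡ ξ̄₂
    chosen-injective ξ̄₁ ξ̄₁-strict ξ̄₂ ξ̄₂-strict =
      Choice.embed-injective ξ̄₁ ξ̄₁-strict (Choice.ξ̄∈ ξ̄₁ ξ̄₁-strict) (Choice.ξ̄∈ ξ̄₂ ξ̄₂-strict)

    Components : Map G R → Set
    Components ξ = ∀ {v w} → v ~ w ⇔ EqClosure (Collapsed {G} {R} ξ) v w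

    module Lifted (ξ : Map G R) (ξ-hom : IsHom G R ξ) (ξ-components : Components ξ) where

      ~-isEquivalence : IsEquivalence _~_
      ~-isEquivalence = SubstEquality.isEquivalence
        ((λ {v w} → from (ξ-components {v} {w})) , (λ {v w} → to (ξ-components {v} {w})))
        (EqClosure.isEquivalence _)

      open Properties ~-isEquivalence public

      ξ-respects : _~_ ⇒ (_≡_ on lookup ξ)
      ξ-respects = EqClosure.gfold ≡-isEquivalence (lookup ξ) proj₂ ∘ to ξ-components

      collapsed⇒~ : Collapsed {G} {R} ξ ⇒ _~_
      collapsed⇒~ = from ξ-components ∘ EqClosure.return

      ξ̄-strict : IsStrict quotient R (factor {R} ξ)
      ξ̄-strict = factor-strict {R} ξ ξ-hom ξ-respects collapsed⇒~

      ζ̄ : Map quotient S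
      ζ̄ = chosen (factor {R} ξ) ξ̄-strict

      ζ : Map G S
      ζ = lift {S} ζ̄

      ζ-hom : IsHom G S ζ
      ζ-hom = lift-hom {S} ζ̄ (proj₁ (chosen-strict _ ξ̄-strict))

      ζ-components : ∀ {v w} → EqClosure (Collapsed {G} {S} ζ) v w ⇔ v ~ w
      ζ-components = mk⇔ (EqClosure.fold ~-isEquivalence (lift-collapsed {S} ζ̄ (chosen-strict _ ξ̄-strict)))
        (EqClosure.map (λ (v⟶w , ξv≡ξw) → v⟶w , lift-respects {S} ζ̄ (collapsed⇒~ (v⟶w , ξv≡ξw))) ∘ to ξ-components)

    lifted-injective : ∀ ξ₁ ξ₁-hom (ξ₁-components : Components ξ₁) ξ₂ ξ₂-hom (ξ₂-components : Components ξ₂) →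
                       Lifted.ζ ξ₁ ξ₁-hom ξ₁-components ≡ Lifted.ζ ξ₂ ξ₂-hom ξ₂-components → ξ₁ ≡ ξ₂
    lifted-injective ξ₁ ξ₁-hom ξ₁-components ξ₂ ξ₂-hom ξ₂-components ζ₁≡ζ₂ = begin
      ξ₁                       ≡⟨ L₁.lift∘factor {R} ξ₁ L₁.ξ-respects ⟨
      lift {R} (factor {R} ξ₁) ≡⟨ cong (lift {R}) ξ̄₁≡ξ̄₂ ⟩
      lift {R} (factor {R} ξ₂) ≡⟨ L₁.lift∘factor {R} ξ₂ L₂.ξ-respects ⟩
      ξ₂                       ∎
      where
      open ≡-Reasoning
      module L₁ = Lifted ξ₁ ξ₁-hom ξ₁-components
      module L₂ = Lifted ξ₂ ξ₂-hom ξ₂-components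
      ξ̄₁≡ξ̄₂ : factor {R} ξ₁ ≡ factor {R} ξ₂
      ξ̄₁≡ξ̄₂ = chosen-injective _ L₁.ξ̄-strict _ L₂.ξ̄-strict
        (trans (sym (L₁.factor∘lift {S} L₁.ζ̄)) (trans (cong (factor {S}) ζ₁≡ζ₂) (L₁.factor∘lift {S} L₂.ζ̄)))

  private
    module Canonical (G : Digraph) (ξ : Hom G R) =
      Lifted G (componentMatrix {G} {R} (proj₁ ξ)) (proj₁ ξ) (proj₂ ξ) (componentMatrix-entry {G} {R} (proj₁ ξ))

  ρ : ∀ G → Hom G R → Hom G S
  ρ G ξ = Canonical.ζ G ξ , Canonical.ζ-hom G ξ

  ρ-components : ∀ G (ξ : Hom G R) {v w} →
                 EqClosure (Collapsed {G} {S} (proj₁ (ρ G ξ))) v w ⇔ EqClosure (Collapsed {G} {R} (proj₁ ξ)) v w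
  ρ-components G ξ = ⇔.trans (Canonical.ζ-components G ξ) (componentMatrix-entry {G} {R} (proj₁ ξ))

  ρ-Γ : ∀ G (ξ : Hom G R) v w → Γ {G} {S} (proj₁ (ρ G ξ)) v w ⇔ Γ {G} {R} (proj₁ ξ) v w
  ρ-Γ G ξ v w = ⇔.trans (Γ⇔EqClosure {G} {S} (proj₁ (ρ G ξ)))
                  (⇔.trans (ρ-components G ξ) (⇔.sym (Γ⇔EqClosure {G} {R} (proj₁ ξ))))

  -- Equal images have equal Γ, hence equal component matrices; then the quotient and the chosen
  -- injection coincide, and ξ is recovered as lift (factor ξ).
  ρ-strong : ∀ G (ξ₁ ξ₂ : Hom G R) → proj₁ (ρ G ξ₁) ≡ proj₁ (ρ G ξ₂) → proj₁ ξ₁ ≡ proj₁ ξ₂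
  ρ-strong G ξ₁@(ξ₁′ , ξ₁-hom) ξ₂@(ξ₂′ , ξ₂-hom) ζ₁≡ζ₂ =
    injective-across same-matrix (componentMatrix-entry {G} {R} ξ₁′) (componentMatrix-entry {G} {R} ξ₂′) ζ₁≡ζ₂
    where
    same-components : ∀ v w → EqClosure (Collapsed {G} {R} ξ₁′) v w ⇔ EqClosure (Collapsed {G} {R} ξ₂′) v w
    same-components v w = ⇔.trans (⇔.sym (ρ-components G ξ₁))
      (subst (λ ζ → EqClosure (Collapsed {G} {S} ζ) v w ⇔ EqClosure (Collapsed {G} {R} ξ₂′) v w)
             (sym ζ₁≡ζ₂) (ρ-components G ξ₂))

    same-matrix : componentMatrix {G} {R} ξ₁′ ≡ componentMatrix {G} {R} ξ₂′
    same-matrix = toMatrix-cong (reachable? (symClosure? (collapsed? {G} {R} ξ₁′)))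
                                (reachable? (symClosure? (collapsed? {G} {R} ξ₂′))) same-components

    injective-across : ∀ {B₁ B₂} → B₁ ≡ B₂ → (c₁ : Components G B₁ ξ₁′) (c₂ : Components G B₂ ξ₂′) →
                       Lifted.ζ G B₁ ξ₁′ ξ₁-hom c₁ ≡ Lifted.ζ G B₂ ξ₂′ ξ₂-hom c₂ → ξ₁′ ≡ ξ₂′
    injective-across refl c₁ c₂ = lifted-injective G _ ξ₁′ ξ₁-hom c₁ ξ₂′ ξ₂-hom c₂

  scheme : R ⊑Γ S wrt D'
  scheme = record { ρ = λ G _ → ρ G ; strong = λ G _ → ρ-strong G ; Γ-pres = λ G _ → ρ-Γ G }

trivialCompletion : ∀ {D' R} → (∀ Q ξ̄ → IsStrict Q R ξ̄ → D' Q) → Completion D' R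
trivialCompletion strict-source-∈ = record
  { completion        = adj
  ; completion-⊇      = λ _ i⟶j → i⟶j
  ; completion-strict = λ _ _ ξ̄-strict → ξ̄-strict
  ; completion-∈      = strict-source-∈
  }

InTa-reflected : ∀ {Q R} {ξ̄ : Map Q R} → IsStrict Q R ξ̄ → InTa R → InTa Q
InTa-reflected {Q} {R} {ξ̄} (_ , ξ̄*-hom) R∈Ta v v⟶⋆v = R∈Ta _ (walk-map {star Q} {star R} {ξ̄} ξ̄*-hom v⟶⋆v)

module _ {R : Digraph} (R-poset : IsPoset R) where
  private
    R-refl    = proj₁ R-poset
    R-antisym = proj₁ (proj₂ R-poset)
    R-trans   = proj₂ (proj₂ R-poset)

  reflexiveTransitiveClosure : (Q : Digraph) → Matrix (suc (k Q))
  reflexiveTransitiveClosure Q = toMatrix (reachable? (arc? Q))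

  module _ {Q : Digraph} {ξ̄ : Map Q R} (ξ̄-strict : IsStrict Q R ξ̄) where

    monotone : ∀ {i j} → Star (Arc Q) i j → Arc R (lookup ξ̄ i) (lookup ξ̄ j)
    monotone = Star.fold (λ i j → Arc R (lookup ξ̄ i) (lookup ξ̄ j))
                         (λ i⟶u ξ̄u≤ξ̄j → R-trans _ _ _ (proj₁ ξ̄-strict _ _ i⟶u) ξ̄u≤ξ̄j) (R-refl _)

    -- a path whose ends have the same image stays inside one fibre, where strictness forbids arcs
    path-collapse : ∀ {i j} → Star (Arc Q) i j → lookup ξ̄ j ≡ lookup ξ̄ i → i ≡ j
    path-collapse ε _ = refl
    path-collapse (i⟶u ◅ u⟶⋆j) ξ̄j≡ξ̄i = trans i≡u (path-collapse u⟶⋆j (trans ξ̄j≡ξ̄i (cong (lookup ξ̄) i≡u)))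
      where
      ξ̄i≡ξ̄u = R-antisym _ _ (proj₁ ξ̄-strict _ _ i⟶u) (subst (Arc R _) ξ̄j≡ξ̄i (monotone u⟶⋆j))
      i≡u = strict⇒separating {Q} {R} {ξ̄} ξ̄-strict (i⟶u , ξ̄i≡ξ̄u)

    private
      Q⁺ = digraph (k Q) (reflexiveTransitiveClosure Q)

      Arc-closure : ∀ i j → Arc Q⁺ i j ⇔ Star (Arc Q) i j
      Arc-closure = toMatrix-entry (reachable? (arc? Q))

    closure-poset : IsPoset Q⁺
    closure-poset =
      (λ i → from (Arc-closure i i) ε) ,
      (λ i j i⟶j j⟶i → path-collapse (to (Arc-closure i j) i⟶j)
         (R-antisym _ _ (monotone (to (Arc-closure j i) j⟶i)) (monotone (to (Arc-closure i j) i⟶j)))) ,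
      (λ i j l i⟶j j⟶l → from (Arc-closure i l) (to (Arc-closure i j) i⟶j ◅◅ to (Arc-closure j l) j⟶l))

    closure-strict : IsStrict Q⁺ R ξ̄
    closure-strict = separating⇒strict {Q⁺} {R} {ξ̄} (λ i j → monotone ∘ to (Arc-closure i j))
      (λ {i j} (i⟶j , ξ̄i≡ξ̄j) → path-collapse (to (Arc-closure i j) i⟶j) (sym ξ̄i≡ξ̄j))

  posetCompletion : ∀ {D'} → (∀ G → D' G ⇔ IsPoset G) → Completion D' R
  posetCompletion D'⇔poset = record
    { completion        = reflexiveTransitiveClosure
    ; completion-⊇      = λ Q {i j} i⟶j → from (toMatrix-entry (reachable? (arc? Q)) i j) (i⟶j ◅ ε)
    ; completion-strict = λ Q ξ̄ → closure-strict {Q} {ξ̄}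
    ; completion-∈      = λ Q ξ̄ ξ̄-strict → from (D'⇔poset _) (closure-poset {Q} {ξ̄} ξ̄-strict)
    }

module LooplessScheme {D' : Class} {R S : Digraph} (R-loopless : ∀ v → ¬ Arc R v v) (R≼S : StrictLeq D' R S) where

  hom⇒strict : ∀ {G} {ξ : Map G R} → IsHom G R ξ → IsStrict G R ξ
  hom⇒strict {G} {ξ} ξ-hom = separating⇒strict {G} {R} {ξ} ξ-hom λ (u⟶w , ξu≡ξw) →
    contradiction (subst (Arc R _) (sym ξu≡ξw) (ξ-hom _ _ u⟶w)) (R-loopless _)

  module _ (G : Digraph) (d : D' G) where
    open Embedding {xs = strictMaps G R} (filter-allMaps-unique G S (isStrict? G S)) (R≼S G d)

    private
      ξ∈ : ∀ (ξ : Hom G R) → proj₁ ξ ∈ strictMaps G R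
      ξ∈ (ξ , ξ-hom) = ∈-filter-allMaps⁺ G R (isStrict? G R) ξ (hom⇒strict {G} {ξ} ξ-hom)

      ρ-strict : ∀ ξ → IsStrict G S (embed (ξ∈ ξ))
      ρ-strict ξ = ∈-filter-allMaps⁻ G S (isStrict? G S) (embed-∈ (ξ∈ ξ))

      Γ⇔≡ : ∀ {H} {ξ : Map G H} → IsStrict G H ξ → ∀ {v w} → Γ {G} {H} ξ v w ⇔ v ≡ w
      Γ⇔≡ {H} {ξ} ξ-strict = mk⇔ (strict⇒Γ-trivial {G} {H} {ξ} ξ-strict) λ { refl → here }

    ρ : Hom G R → Hom G S
    ρ ξ = embed (ξ∈ ξ) , proj₁ (ρ-strict ξ)

    ρ-strong : ∀ ξ₁ ξ₂ → proj₁ (ρ ξ₁) ≡ proj₁ (ρ ξ₂) → proj₁ ξ₁ ≡ proj₁ ξ₂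
    ρ-strong ξ₁ ξ₂ = embed-injective (ξ∈ ξ₁) (ξ∈ ξ₂)

    ρ-Γ : ∀ ξ v w → Γ {G} {S} (proj₁ (ρ ξ)) v w ⇔ Γ {G} {R} (proj₁ ξ) v w
    ρ-Γ (ξ , ξ-hom) v w = ⇔.trans (Γ⇔≡ {S} {embed (ξ∈ (ξ , ξ-hom))} (ρ-strict (ξ , ξ-hom)))
                                  (⇔.sym (Γ⇔≡ {R} {ξ} (hom⇒strict {G} {ξ} ξ-hom)))

  scheme : R ⊑Γ S wrt D'
  scheme = record { ρ = ρ ; strong = ρ-strong ; Γ-pres = ρ-Γ }

strictLeq⇒scheme : ∀ {D' R S} → Hyp D' R → StrictLeq D' R S → R ⊑Γ S wrt D'
strictLeq⇒scheme {D'} {R} {S} (inj₁ all-in-D') =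
  Construction.scheme {D'} {R} {S} (trivialCompletion λ Q _ _ → all-in-D' Q)
strictLeq⇒scheme {D'} {R} {S} (inj₂ (inj₁ (R∈Ta , Ta⊆D'))) =
  Construction.scheme {D'} {R} {S}
    (trivialCompletion λ Q ξ̄ ξ̄-strict → Ta⊆D' Q (InTa-reflected {Q} {R} {ξ̄} ξ̄-strict R∈Ta))
strictLeq⇒scheme {D'} {R} {S} (inj₂ (inj₂ (inj₁ D'⇔poset , R∈D'))) =
  Construction.scheme {D'} {R} {S} (posetCompletion (to (D'⇔poset R) R∈D') D'⇔poset)
strictLeq⇒scheme {D'} {R} {S} (inj₂ (inj₂ (inj₂ D'⇔P* , R∈D'))) =
  LooplessScheme.scheme {D'} {R} {S} (P*-loopless {R} (to (D'⇔P* R) R∈D'))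

module _ {D' : Class} {R S : Digraph} (R⊑S : R ⊑Γ S wrt D') where
  open StrongΓScheme R⊑S

  scheme⇒strictLeq : StrictLeq D' R S
  scheme⇒strictLeq G d = #filter-allMaps-≤ G R G S (isStrict? G R) (isStrict? G S)
    (λ ξ ξ-strict → proj₁ (ρ G d (ξ , proj₁ ξ-strict))) ρ-strict
    (λ ξ₁ ξ₁-strict ξ₂ ξ₂-strict → strong G d (ξ₁ , proj₁ ξ₁-strict) (ξ₂ , proj₁ ξ₂-strict))
    where
    ρ-strict : ∀ ξ (ξ-strict : IsStrict G R ξ) → IsStrict G S (proj₁ (ρ G d (ξ , proj₁ ξ-strict)))
    ρ-strict ξ ξ-strict =
      Γ-trivial⇒strict {G} {S} {proj₁ (ρ G d (ξ , proj₁ ξ-strict))} (proj₂ (ρ G d (ξ , proj₁ ξ-strict)))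
        (strict⇒Γ-trivial {G} {R} {ξ} ξ-strict ∘ to (Γ-pres G d (ξ , proj₁ ξ-strict) _ _))

  scheme⇒homLeq : HomLeq D' R S
  scheme⇒homLeq G d = #filter-allMaps-≤ G R G S (isHom? G R) (isHom? G S)
    (λ ξ ξ-hom → proj₁ (ρ G d (ξ , ξ-hom))) (λ ξ ξ-hom → proj₂ (ρ G d (ξ , ξ-hom)))
    (λ ξ₁ ξ₁-hom ξ₂ ξ₂-hom → strong G d (ξ₁ , ξ₁-hom) (ξ₂ , ξ₂-hom))

theorem2 : (R : Digraph) (D' : Class) → Hyp D' R → (S : Digraph)
         → ((R ⊑Γ S wrt D') ⇔ StrictLeq D' R S)
           × (StrictLeq D' R S → HomLeq D' R S)
theorem2 R D' hyp S =
  mk⇔ (scheme⇒strictLeq {D'} {R} {S}) (strictLeq⇒scheme {D'} {R} {S} hyp) ,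
  scheme⇒homLeq {D'} {R} {S} ∘ strictLeq⇒scheme {D'} {R} {S} hyp
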